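{- Let $R\supseteq S$ be commutative rings such that $R$ is a free $S$-module of rank $k$. Then $\mathcal{P}(R)\leq g_S(k)$.
   Context: For a commutative ring $R$, let $\sum R^2$ be the set of finite sums of squares of elements of $R$; for $\alpha\in\sum R^2$ its length $\ell(\alpha)$ is the least $n$ such that $\alpha$ is a sum of $n$ squares in $R$, and the Pythagoras number is $\mathcal{P}(R)=\sup\{\ell(\alpha):\alpha\in\sum R^2\}$. For a commutative ring $S$ and $k\geq 1$, let $\mathrm{Sq}_k$ be the set of $k$-ary quadratic forms over $S$ that can be written as a finite sum of squares of linear forms in $k$ variables with coefficients in $S$. The $g$-invariant $g_S(k)$ is the least $n$ such that every form in $\mathrm{Sq}_k$ is a sum of $n$ squares of linear forms over $S$ (i.e. is represented by $I_n=X_1^2+\dots+X_n^2$); $g_S(k)=\infty$ if no such $n$ exists. -}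

module Defs where

open import Level using (Level; _⊔_)
open import Data.Nat using (ℕ; zero; suc; _≤_)
open import Data.Fin using (Fin; zero; suc) renaming (_≤_ to _≤ᶠ_)
open import Data.Fin.Properties using () renaming (_≟_ to _≟ᶠ_)
open import Data.Product using (Σ; ∃; _×_; _,_)
open import Relation.Nullary using (yes; no)
open import Algebra.Bundles using (CommutativeRing)
open import Algebra.Morphism.Structures using (IsRingMonomorphism)

private
  variable
    c ℓ c₁ ℓ₁ c₂ ℓ₂ : Level

module _ (A : CommutativeRing c ℓ) where
  open CommutativeRing A using (Carrier; _≈_; _+_; _*_; 0#)

  ∑ : (m : ℕ) → (Fin m → Carrier) → Carrier
  ∑ zero    f = 0#
  ∑ (suc m) f = f zero + ∑ m (λ i → f (suc i))

  SumOfSquares : ℕ → Carrier → Set (c ⊔ ℓ)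
  SumOfSquares m α = Σ (Fin m → Carrier) λ x → α ≈ ∑ m (λ i → x i * x i)

  IsSumOfSquares : Carrier → Set (c ⊔ ℓ)
  IsSumOfSquares α = ∃ λ m → SumOfSquares m α

  LengthAtMost : ℕ → Carrier → Set (c ⊔ ℓ)
  LengthAtMost n α = ∃ λ m → m ≤ n × SumOfSquares m α

  PythagorasAtMost : ℕ → Set (c ⊔ ℓ)
  PythagorasAtMost n = ∀ α → IsSumOfSquares α → LengthAtMost n α

  -- Quadratic forms in k variables are represented by their coefficients:
  -- the coefficient of X_i X_j (for i ≤ j) is  Q i j ;  entries with i > j
  -- are irrelevant.
  -- Coefficient of X_i X_j (i ≤ j) in the square of the linear form l :
  -- l_i² if i = j, and 2 l_i l_j = l_i l_j + l_j l_i if i < j.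
  sqCoeff : {k : ℕ} → (Fin k → Carrier) → Fin k → Fin k → Carrier
  sqCoeff l i j with i ≟ᶠ j
  ... | yes _ = l i * l i
  ... | no  _ = l i * l j + l j * l i

  sumSqForm : {k : ℕ} (m : ℕ) → (Fin m → Fin k → Carrier) → Fin k → Fin k → Carrier
  sumSqForm m ls i j = ∑ m (λ t → sqCoeff (ls t) i j)

  _≈Form_ : {k : ℕ} → (Fin k → Fin k → Carrier) → (Fin k → Fin k → Carrier) → Set (ℓ)
  _≈Form_ {k} Q Q' = ∀ (i j : Fin k) → i ≤ᶠ j → Q i j ≈ Q' i j

  RepresentedBySumOf : (k n : ℕ) → (Fin k → Fin k → Carrier) → Set (c ⊔ ℓ)
  RepresentedBySumOf k n Q = Σ (Fin n → Fin k → Carrier) λ ls → Q ≈Form sumSqForm n ls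

  InSq : (k : ℕ) → (Fin k → Fin k → Carrier) → Set (c ⊔ ℓ)
  InSq k Q = ∃ λ m → RepresentedBySumOf k m Q

  gInvariantAtMost : (k n : ℕ) → Set (c ⊔ ℓ)
  gInvariantAtMost k n = ∀ Q → InSq k Q → RepresentedBySumOf k n Q

-- R ⊇ S with ι : S ↪ R the inclusion (an injective ring homomorphism), and
-- R is a free S-module (via ι) of rank k with basis e : Fin k → R :
-- every r ∈ R is uniquely of the form ∑ ι(s_i) e_i.
record IsFreeOfRank (S : CommutativeRing c₁ ℓ₁) (R : CommutativeRing c₂ ℓ₂)
                    (ι : CommutativeRing.Carrier S → CommutativeRing.Carrier R)
                    (k : ℕ) : Set (c₁ ⊔ ℓ₁ ⊔ c₂ ⊔ ℓ₂) where
  private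
    module S = CommutativeRing S
    module R = CommutativeRing R
  lincomb : (Fin k → R.Carrier) → (Fin k → S.Carrier) → R.Carrier
  lincomb e s = ∑ R k (λ i → ι (s i) R.* e i)
  field
    basis    : Fin k → R.Carrier
    spanning : ∀ r → Σ (Fin k → S.Carrier) λ s → r R.≈ lincomb basis s
    independent : ∀ (s t : Fin k → S.Carrier) →
                  lincomb basis s R.≈ lincomb basis t → ∀ i → s i S.≈ t i

record FreeExtensionOfRank (S : CommutativeRing c₁ ℓ₁) (R : CommutativeRing c₂ ℓ₂)
                           (k : ℕ) : Set (c₁ ⊔ ℓ₁ ⊔ c₂ ⊔ ℓ₂) where
  field
    ι      : CommutativeRing.Carrier S → CommutativeRing.Carrier R
    isMono : IsRingMonomorphism (CommutativeRing.rawRing S) (CommutativeRing.rawRing R) ι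
    free   : IsFreeOfRank S R ι k

-- Choose an S-basis e₁,…,e_k of R. Substituting X_i ↦ e_i turns a k-ary
-- quadratic form over S into an element of R, and equal forms give equal
-- elements. Writing each x_t of α = x₁² + … + x_m² as ∑ s_{ti} e_i exhibits α as
-- the value of the form ∑_t (∑_i s_{ti} X_i)² ∈ Sq_k; this form is a sum of
-- g_S(k) squares of linear forms, and substituting again writes α as a sum of
-- g_S(k) squares in R.
module Submission where

open import Defs
open import Level using (Level)
open import Data.Nat using (ℕ; zero; suc; z≤n; s≤s)
open import Data.Nat.Properties using (≤-refl)
open import Data.Fin using (Fin; zero; suc)
open import Data.Fin.Properties using () renaming (_≟_ to _≟ᶠ_)
open import Data.Product using (Σ; _,_; proj₁; proj₂)
open import Relation.Nullary using (yes; no)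
open import Relation.Binary.PropositionalEquality as ≡ using (_≡_)
open import Algebra.Bundles using (CommutativeRing)
open import Algebra.Morphism.Structures using (IsRingHomomorphism; IsRingMonomorphism)

module QuadraticFormValues {c ℓ} (R : CommutativeRing c ℓ) where
  open CommutativeRing R hiding (zero)
  open import Algebra.Properties.Semiring.Sum semiring
    using (sum; sum-cong-≋; sum-replicate-zero; ∑-distrib-+; *-distribˡ-sum; *-distribʳ-sum)
  open import Algebra.Solver.Ring.NaturalCoefficients.Default commutativeSemiring
  open import Relation.Binary.Reasoning.Setoid setoid

  ∑≡sum : ∀ m (f : Fin m → Carrier) → ∑ R m f ≡ sum f
  ∑≡sum zero    f = ≡.refl
  ∑≡sum (suc m) f = ≡.cong (f zero +_) (∑≡sum m (λ i → f (suc i)))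

  ∑-cong : ∀ m {f g : Fin m → Carrier} → (∀ i → f i ≈ g i) → ∑ R m f ≈ ∑ R m g
  ∑-cong zero    f≈g = refl
  ∑-cong (suc m) f≈g = +-cong (f≈g zero) (∑-cong m (λ i → f≈g (suc i)))

  evalLinear : ∀ {k} → (Fin k → Carrier) → (Fin k → Carrier) → Carrier
  evalLinear a e = sum (λ i → a i * e i)

  -- Q(e) = ∑_{i ≤ j} Q i j e_i e_j : only the coefficients with i ≤ j are read,
  -- matching the encoding of forms in Defs.
  evalForm : ∀ {k} → (Fin k → Fin k → Carrier) → (Fin k → Carrier) → Carrier
  evalForm {zero}  Q e = 0#
  evalForm {suc k} Q e =
    Q zero zero * (e zero * e zero)
      + (sum (λ j → Q zero (suc j) * (e zero * e (suc j)))
      + evalForm (λ i j → Q (suc i) (suc j)) (λ i → e (suc i)))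

  evalForm-cong : ∀ {k} {Q Q′ : Fin k → Fin k → Carrier} (e : Fin k → Carrier) →
                  _≈Form_ R Q Q′ → evalForm Q e ≈ evalForm Q′ e
  evalForm-cong {zero}  e Q≈Q′ = refl
  evalForm-cong {suc k} e Q≈Q′ =
    +-cong (*-cong (Q≈Q′ zero zero z≤n) refl)
      (+-cong (sum-cong-≋ (λ j → *-cong (Q≈Q′ zero (suc j) z≤n) refl))
              (evalForm-cong _ (λ i j i≤j → Q≈Q′ (suc i) (suc j) (s≤s i≤j))))

  evalForm-zero : ∀ {k} (e : Fin k → Carrier) → evalForm (λ _ _ → 0#) e ≈ 0#
  evalForm-zero {zero}  e = refl
  evalForm-zero {suc k} e = begin
    0# * (e zero * e zero)
      + (sum (λ j → 0# * (e zero * e (suc j))) + evalForm (λ _ _ → 0#) (λ i → e (suc i)))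
      ≈⟨ +-cong (zeroˡ _) (+-cong (trans (sum-cong-≋ (λ j → zeroˡ (e zero * e (suc j))))
                                         (sum-replicate-zero k))
                                  (evalForm-zero (λ i → e (suc i)))) ⟩
    0# + (0# + 0#)
      ≈⟨ solve 0 (con 0 :+ (con 0 :+ con 0) := con 0) refl ⟩
    0# ∎

  evalForm-+ : ∀ {k} (Q Q′ : Fin k → Fin k → Carrier) (e : Fin k → Carrier) →
               evalForm (λ i j → Q i j + Q′ i j) e ≈ evalForm Q e + evalForm Q′ e
  evalForm-+ {zero}  Q Q′ e = sym (+-identityˡ 0#)
  evalForm-+ {suc k} Q Q′ e = begin
    (Q zero zero + Q′ zero zero) * (e zero * e zero)
      + (sum (λ j → (Q zero (suc j) + Q′ zero (suc j)) * (e zero * e (suc j)))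
      + evalForm (λ i j → Q (suc i) (suc j) + Q′ (suc i) (suc j)) (λ i → e (suc i)))
      ≈⟨ +-cong (distribʳ _ _ _)
           (+-cong (trans (sum-cong-≋ (λ j → distribʳ (e zero * e (suc j)) _ _))
                          (∑-distrib-+ (λ j → Q zero (suc j) * (e zero * e (suc j)))
                                       (λ j → Q′ zero (suc j) * (e zero * e (suc j)))))
                   (evalForm-+ (λ i j → Q (suc i) (suc j)) (λ i j → Q′ (suc i) (suc j))
                               (λ i → e (suc i)))) ⟩
    (u + u′) + ((v + v′) + (w + w′))
      ≈⟨ solve 6 (λ a a′ b b′ c c′ → (a :+ a′) :+ ((b :+ b′) :+ (c :+ c′))
                                  := (a :+ (b :+ c)) :+ (a′ :+ (b′ :+ c′))) refl u u′ v v′ w w′ ⟩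
    evalForm Q e + evalForm Q′ e ∎
    where
      u u′ v v′ w w′ : Carrier
      u  = Q zero zero * (e zero * e zero)
      u′ = Q′ zero zero * (e zero * e zero)
      v  = sum (λ j → Q zero (suc j) * (e zero * e (suc j)))
      v′ = sum (λ j → Q′ zero (suc j) * (e zero * e (suc j)))
      w  = evalForm (λ i j → Q (suc i) (suc j)) (λ i → e (suc i))
      w′ = evalForm (λ i j → Q′ (suc i) (suc j)) (λ i → e (suc i))

  evalForm-∑ : ∀ {k} m (Q : Fin m → Fin k → Fin k → Carrier) (e : Fin k → Carrier) →
               evalForm (λ i j → ∑ R m (λ t → Q t i j)) e ≈ ∑ R m (λ t → evalForm (Q t) e)
  evalForm-∑ zero    Q e = evalForm-zero e
  evalForm-∑ (suc m) Q e =
    trans (evalForm-+ _ _ e) (+-cong refl (evalForm-∑ m (λ t → Q (suc t)) e))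

  sqCoeff-suc : ∀ {k} (a : Fin (suc k) → Carrier) (i j : Fin k) →
                sqCoeff R a (suc i) (suc j) ≡ sqCoeff R (λ x → a (suc x)) i j
  sqCoeff-suc a i j with i ≟ᶠ j
  ... | yes _ = ≡.refl
  ... | no  _ = ≡.refl

  evalForm-sqCoeff : ∀ {k} (a e : Fin k → Carrier) →
                     evalForm (sqCoeff R a) e ≈ evalLinear a e * evalLinear a e
  evalForm-sqCoeff {zero}  a e = sym (zeroˡ 0#)
  evalForm-sqCoeff {suc k} a e = sym (begin
    (A + X) * (A + X)
      ≈⟨ solve 2 (λ A X → (A :+ X) :* (A :+ X) := A :* A :+ ((A :* X :+ X :* A) :+ X :* X))
               refl A X ⟩
    A * A + ((A * X + X * A) + X * X)
      ≈⟨ +-cong (solve 2 (λ x u → (x :* u) :* (x :* u) := (x :* x) :* (u :* u))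
                       refl (a zero) (e zero))
                (+-cong cross
                        (trans (sym (evalForm-sqCoeff (λ i → a (suc i)) (λ i → e (suc i))))
                               (evalForm-cong _ (λ i j _ → reflexive (≡.sym (sqCoeff-suc a i j)))))) ⟩
    evalForm (sqCoeff R a) e ∎)
    where
      A X : Carrier
      A = a zero * e zero
      X = evalLinear (λ i → a (suc i)) (λ i → e (suc i))
      cross : A * X + X * A ≈ sum (λ j → sqCoeff R a zero (suc j) * (e zero * e (suc j)))
      cross = begin
        A * X + X * A
          ≈⟨ +-cong (*-distribˡ-sum A (λ j → a (suc j) * e (suc j)))
                    (*-distribʳ-sum A (λ j → a (suc j) * e (suc j))) ⟩
        sum (λ j → A * (a (suc j) * e (suc j))) + sum (λ j → (a (suc j) * e (suc j)) * A)
          ≈⟨ sym (∑-distrib-+ (λ j → A * (a (suc j) * e (suc j)))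
                              (λ j → (a (suc j) * e (suc j)) * A)) ⟩
        sum (λ j → A * (a (suc j) * e (suc j)) + (a (suc j) * e (suc j)) * A)
          ≈⟨ sum-cong-≋ (λ j →
               solve 4 (λ x y u v → (x :* u) :* (y :* v) :+ (y :* v) :* (x :* u)
                                 := (x :* y :+ y :* x) :* (u :* v))
                     refl (a zero) (a (suc j)) (e zero) (e (suc j))) ⟩
        sum (λ j → sqCoeff R a zero (suc j) * (e zero * e (suc j))) ∎

  evalForm-sumSqForm : ∀ {k} m (ls : Fin m → Fin k → Carrier) (e : Fin k → Carrier) →
                       evalForm (sumSqForm R m ls) e
                         ≈ ∑ R m (λ t → evalLinear (ls t) e * evalLinear (ls t) e)
  evalForm-sumSqForm m ls e =
    trans (evalForm-∑ m (λ t → sqCoeff R (ls t)) e) (∑-cong m (λ t → evalForm-sqCoeff (ls t) e))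

module BaseChange {c₁ ℓ₁ c₂ ℓ₂} (S : CommutativeRing c₁ ℓ₁) (R : CommutativeRing c₂ ℓ₂)
  {ι : CommutativeRing.Carrier S → CommutativeRing.Carrier R}
  (isHom : IsRingHomomorphism (CommutativeRing.rawRing S) (CommutativeRing.rawRing R) ι) where
  module S = CommutativeRing S
  open CommutativeRing R hiding (zero)
  open IsRingHomomorphism isHom
  open QuadraticFormValues R
  open import Relation.Binary.Reasoning.Setoid setoid

  ι-∑ : ∀ m (f : Fin m → S.Carrier) → ι (∑ S m f) ≈ ∑ R m (λ t → ι (f t))
  ι-∑ zero    f = 0#-homo
  ι-∑ (suc m) f = trans (+-homo _ _) (+-cong refl (ι-∑ m _))

  ι-sqCoeff : ∀ {k} (l : Fin k → S.Carrier) i j →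
              ι (sqCoeff S l i j) ≈ sqCoeff R (λ x → ι (l x)) i j
  ι-sqCoeff l i j with i ≟ᶠ j
  ... | yes _ = *-homo _ _
  ... | no  _ = trans (+-homo _ _) (+-cong (*-homo _ _) (*-homo _ _))

  ι-sumSqForm : ∀ {k} m (ls : Fin m → Fin k → S.Carrier) i j →
                ι (sumSqForm S m ls i j) ≈ sumSqForm R m (λ t x → ι (ls t x)) i j
  ι-sumSqForm m ls i j = trans (ι-∑ m _) (∑-cong m (λ t → ι-sqCoeff (ls t) i j))

  sumOfSquares-substitution :
    ∀ {k} m n (ls : Fin m → Fin k → S.Carrier) (ls′ : Fin n → Fin k → S.Carrier) →
    _≈Form_ S (sumSqForm S m ls) (sumSqForm S n ls′) → (e : Fin k → Carrier) →
    ∑ R m (λ t → evalLinear (λ i → ι (ls t i)) e * evalLinear (λ i → ι (ls t i)) e)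
      ≈ ∑ R n (λ u → evalLinear (λ i → ι (ls′ u i)) e * evalLinear (λ i → ι (ls′ u i)) e)
  sumOfSquares-substitution m n ls ls′ ls≈ls′ e = begin
    ∑ R m (λ t → evalLinear (λ i → ι (ls t i)) e * evalLinear (λ i → ι (ls t i)) e)
      ≈⟨ sym (evalForm-sumSqForm m _ e) ⟩
    evalForm (sumSqForm R m (λ t i → ι (ls t i))) e
      ≈⟨ evalForm-cong e (λ i j i≤j →
           trans (sym (ι-sumSqForm m ls i j))
                 (trans (⟦⟧-cong (ls≈ls′ i j i≤j)) (ι-sumSqForm n ls′ i j))) ⟩
    evalForm (sumSqForm R n (λ u i → ι (ls′ u i))) e
      ≈⟨ evalForm-sumSqForm n _ e ⟩
    ∑ R n (λ u → evalLinear (λ i → ι (ls′ u i)) e * evalLinear (λ i → ι (ls′ u i)) e) ∎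

  pythagorasAtMost-of-spanning :
    ∀ {k n} (e : Fin k → Carrier) →
    (∀ r → Σ (Fin k → S.Carrier) λ s → r ≈ ∑ R k (λ i → ι (s i) * e i)) →
    gInvariantAtMost S k n → PythagorasAtMost R n
  pythagorasAtMost-of-spanning {k} {n} e spans g α (m , x , α≈) =
    n , ≤-refl , (λ u → evalLinear (λ i → ι (ls′ u i)) e) , (begin
      α
        ≈⟨ α≈ ⟩
      ∑ R m (λ t → x t * x t)
        ≈⟨ ∑-cong m (λ t → *-cong (x≈ t) (x≈ t)) ⟩
      ∑ R m (λ t → evalLinear (λ i → ι (s t i)) e * evalLinear (λ i → ι (s t i)) e)
        ≈⟨ sumOfSquares-substitution m n s ls′ s≈ls′ e ⟩
      ∑ R n (λ u → evalLinear (λ i → ι (ls′ u i)) e * evalLinear (λ i → ι (ls′ u i)) e) ∎)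
    where
      s : Fin m → Fin k → S.Carrier
      s t = proj₁ (spans (x t))
      x≈ : ∀ t → x t ≈ evalLinear (λ i → ι (s t i)) e
      x≈ t = trans (proj₂ (spans (x t))) (reflexive (∑≡sum k _))
      representation : RepresentedBySumOf S k n (sumSqForm S m s)
      representation = g (sumSqForm S m s) (m , s , λ i j _ → S.refl)
      ls′ : Fin n → Fin k → S.Carrier
      ls′ = proj₁ representation
      s≈ls′ : _≈Form_ S (sumSqForm S m s) (sumSqForm S n ls′)
      s≈ls′ = proj₂ representation

proposition7p5 : ∀ {c₁ ℓ₁ c₂ ℓ₂ : Level}
    (S : CommutativeRing c₁ ℓ₁) (R : CommutativeRing c₂ ℓ₂) (k : ℕ) →
    FreeExtensionOfRank S R k →
    ∀ (n : ℕ) → gInvariantAtMost S k n → PythagorasAtMost R n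
proposition7p5 S R k extension n =
  pythagorasAtMost-of-spanning (IsFreeOfRank.basis free) (IsFreeOfRank.spanning free)
  where
    open FreeExtensionOfRank extension
    open BaseChange S R (IsRingMonomorphism.isRingHomomorphism isMono)
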